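{- Let $b,c,d$ be integers with $c>0$, $b\equiv 2\pmod 4$, $d=b^2+c^2$ squarefree and $d\equiv 5\pmod 8$. For integers $C,D$ put $$p=\frac{1}{16}\left(\left(\frac b2C^2+cCD-\frac b2D^2\right)^2+dC^2+dD^2+d\right),\qquad I=\frac14\left|cC^2-2bCD-cD^2\right|.$$ If $p$ and $I$ are both integers, then $C$ and $D$ are both odd. -}

module Defs where

open import Data.Integer using (ℤ; _*_; _+_; _-_; +_)
open import Data.Integer.Divisibility using (_∣_)

open import Relation.Binary.PropositionalEquality using (_≡_)

SquareFree : ℤ → Set
SquareFree d = ∀ (m : ℤ) → (m * m) ∣ d → m * m ≡ + 1

-- numerator of 16 p, where h = b/2
pNum : ℤ → ℤ → ℤ → ℤ → ℤ → ℤ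
pNum h c d C D =
  let t = h * C * C + c * C * D - h * D * D
  in t * t + d * C * C + d * D * D + d

-- the quantity inside |.| of 4 I
iNum : ℤ → ℤ → ℤ → ℤ → ℤ
iNum b c C D = c * C * C - + 2 * b * C * D - c * D * D

-- Only parity matters.  As b is even and d = b² + c² is odd, c is odd.  Modulo 2,
-- 16p ≡ d when C and D are both even, and 4I ≡ c·D² or c·C² when exactly C or
-- exactly D is even; both are odd, contradicting 16 ∣ 16p resp. 4 ∣ 4I.
module Submission where

open import Defs
open import Data.Integer using (ℤ; _*_; _+_; _-_; +_; _>_; ∣_∣; +0)
open import Data.Integer.Divisibility using (_∣_)
open import Data.Integer.DivMod using (_%_; _/_; a≡a%n+[a/n]*n; n%d<d)
open import Data.Integer.Properties using (+-identityˡ; neg-involutive; *-comm)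
open import Data.Integer.Tactic.RingSolver using (solve-∀)
import Data.Integer.Divisibility.Signed as Signed
open import Data.Nat using (suc; s≤s; z≤n)
open import Data.Nat.Divisibility using (>⇒∤) renaming (_∣_ to _∣ℕ_)
open import Data.Product using (∃; _×_; _,_)
open import Data.Sum using (_⊎_; inj₁; inj₂)
open import Relation.Nullary using (¬_; contradiction)
open import Relation.Binary.PropositionalEquality using (_≡_; refl; sym; trans; subst)

open Signed using (divides; ∣-refl; ∣-trans; ∣ᵤ⇒∣; ∣⇒∣ᵤ; ∣m⇒∣m*n; ∣n⇒∣m*n;
                   ∣m∣n⇒∣m+n; ∣m∣n⇒∣m-n; ∣m⇒∣-m; ∣m+n∣m⇒∣n; ∣m+n∣n⇒∣m)

Even : ℤ → Set
Even x = + 2 Signed.∣ x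

Odd : ℤ → Set
Odd x = ∃ λ k → x ≡ + 2 * k + + 1

even-or-odd : ∀ x → Even x ⊎ Odd x
even-or-odd x with x % + 2 | n%d<d x (+ 2) | a≡a%n+[a/n]*n x (+ 2)
... | 0           | _             | x≡ = inj₁ (divides (x / + 2) (trans x≡ (+-identityˡ _)))
... | suc (suc _) | s≤s (s≤s ())  | _
... | 1           | _             | x≡ = inj₂ (x / + 2 , trans x≡ (1+q*2≡2*q+1 (x / + 2)))
  where
  1+q*2≡2*q+1 : ∀ q → + 1 + q * + 2 ≡ + 2 * q + + 1
  1+q*2≡2*q+1 = solve-∀

odd⇒¬even : ∀ {x} → Odd x → ¬ Even x
odd⇒¬even {x} (k , x≡2k+1) 2∣x = >⇒∤ (s≤s (s≤s z≤n)) (∣⇒∣ᵤ 2∣1)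
  where
  2∣1 : Even (+ 1)
  2∣1 = ∣m+n∣m⇒∣n (subst Even x≡2k+1 2∣x) (∣m⇒∣m*n k ∣-refl)

odd*odd : ∀ {x y} → Odd x → Odd y → Odd (x * y)
odd*odd (a , refl) (b , refl) = + 2 * a * b + a + b , product-identity a b
  where
  product-identity : ∀ a b → (+ 2 * a + + 1) * (+ 2 * b + + 1) ≡ + 2 * (+ 2 * a * b + a + b) + + 1
  product-identity = solve-∀

8k+5-odd : ∀ k → Odd (+ 8 * k + + 5)
8k+5-odd k = + 4 * k + + 2 , 8k+5≡2[4k+2]+1 k
  where
  8k+5≡2[4k+2]+1 : ∀ k → + 8 * k + + 5 ≡ + 2 * (+ 4 * k + + 2) + + 1
  8k+5≡2[4k+2]+1 = solve-∀

odd-sum-of-squares⇒odd : ∀ {b c} → Even b → Odd (b * b + c * c) → Odd c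
odd-sum-of-squares⇒odd {b} {c} 2∣b odd-sum with even-or-odd c
... | inj₂ odd-c = odd-c
... | inj₁ 2∣c   = contradiction (∣m∣n⇒∣m+n (∣m⇒∣m*n b 2∣b) (∣m⇒∣m*n c 2∣c)) (odd⇒¬even odd-sum)

pNum-odd-at-even-even : ∀ h c {d C D} → Odd d → Even C → Even D → ¬ Even (pNum h c d C D)
pNum-odd-at-even-even h c {d} {C} {D} odd-d 2∣C 2∣D 2∣p =
  odd⇒¬even odd-d (∣m+n∣m⇒∣n 2∣p 2∣p-d)
  where
  t : ℤ
  t = h * C * C + c * C * D - h * D * D
  2∣t : Even t
  2∣t = ∣m∣n⇒∣m-n (∣m∣n⇒∣m+n (∣m⇒∣m*n C (∣n⇒∣m*n h 2∣C)) (∣m⇒∣m*n D (∣n⇒∣m*n c 2∣C)))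
                  (∣n⇒∣m*n (h * D) 2∣D)
  2∣p-d : Even (t * t + d * C * C + d * D * D)
  2∣p-d = ∣m∣n⇒∣m+n (∣m∣n⇒∣m+n (∣m⇒∣m*n t 2∣t) (∣n⇒∣m*n (d * C) 2∣C)) (∣n⇒∣m*n (d * D) 2∣D)

2∣2bCD : ∀ b C D → Even (+ 2 * b * C * D)
2∣2bCD b C D = ∣m⇒∣m*n D (∣m⇒∣m*n C (∣m⇒∣m*n b ∣-refl))

iNum-odd-at-even-odd : ∀ b {c C D} → Odd c → Even C → Odd D → ¬ Even (iNum b c C D)
iNum-odd-at-even-odd b {c} {C} {D} odd-c 2∣C odd-D 2∣i =
  odd⇒¬even (odd*odd (odd*odd odd-c odd-D) odd-D)
    (subst Even (neg-involutive _) (∣m⇒∣-m (∣m+n∣m⇒∣n 2∣i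
      (∣m∣n⇒∣m-n (∣n⇒∣m*n (c * C) 2∣C) (2∣2bCD b C D)))))

iNum-odd-at-odd-even : ∀ b {c C D} → Odd c → Odd C → Even D → ¬ Even (iNum b c C D)
iNum-odd-at-odd-even b {c} {C} {D} odd-c odd-C 2∣D 2∣i =
  odd⇒¬even (odd*odd (odd*odd odd-c odd-C) odd-C)
    (∣m+n∣n⇒∣m (∣m+n∣n⇒∣m 2∣i (∣m⇒∣-m (∣n⇒∣m*n (c * D) 2∣D))) (∣m⇒∣-m (2∣2bCD b C D)))

mainTheorem6 : ∀ (b c d C D : ℤ) → c > +0 → (b≡2mod4 : ∃ λ k → b ≡ + 4 * k + + 2) → d ≡ b * b + c * c → SquareFree d → (∃ λ k → d ≡ + 8 * k + + 5) → ∀ (h : ℤ) → b ≡ + 2 * h → (+ 16) ∣ pNum h c d C D → (4 ∣ℕ ∣ iNum b c C D ∣) → (∃ λ m → C ≡ + 2 * m + + 1) × (∃ λ n → D ≡ + 2 * n + + 1)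
mainTheorem6 b c d C D _ _ d≡b²+c² _ (k , d≡8k+5) h b≡2h 16∣p 4∣i =
  by-parity (even-or-odd C) (even-or-odd D)
  where
  odd-d : Odd d
  odd-d = subst Odd (sym d≡8k+5) (8k+5-odd k)
  odd-c : Odd c
  odd-c = odd-sum-of-squares⇒odd (divides h (trans b≡2h (*-comm (+ 2) h))) (subst Odd d≡b²+c² odd-d)
  2∣p : Even (pNum h c d C D)
  2∣p = ∣-trans (divides (+ 8) refl) (∣ᵤ⇒∣ 16∣p)
  2∣i : Even (iNum b c C D)
  2∣i = ∣-trans (divides (+ 2) refl) (∣ᵤ⇒∣ 4∣i)
  by-parity : Even C ⊎ Odd C → Even D ⊎ Odd D → Odd C × Odd D
  by-parity (inj₂ odd-C) (inj₂ odd-D) = odd-C , odd-D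
  by-parity (inj₁ 2∣C)   (inj₁ 2∣D)   = contradiction 2∣p (pNum-odd-at-even-even h c odd-d 2∣C 2∣D)
  by-parity (inj₁ 2∣C)   (inj₂ odd-D) = contradiction 2∣i (iNum-odd-at-even-odd b odd-c 2∣C odd-D)
  by-parity (inj₂ odd-C) (inj₁ 2∣D)   = contradiction 2∣i (iNum-odd-at-odd-even b odd-c odd-C 2∣D)
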